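{- Let $a_1,\dots,a_s$ be positive integers, let $m=\sum_{i=1}^s(a_i-1)+1$ and $p=\max\{a_1,\dots,a_s\}$, and let $q>p$ be an integer. Then $$F_v(\underbrace{2,\dots,2}_{m-p},p;q)\le F_v(a_1,\dots,a_s;q)\le \widetilde{F}_v(m;p;q).$$
   Context: All graphs are finite, simple and undirected; $\omega(G)$ is the clique number. For positive integers $b_1,\dots,b_t$, $G\overset{v}{\rightarrow}(b_1,\dots,b_t)$ means: for every coloring of $V(G)$ in $t$ colors there is $i\in\{1,\dots,t\}$ such that $G$ contains a $b_i$-clique all of whose vertices have color $i$. The vertex Folkman number $F_v(b_1,\dots,b_t;q)$ is the minimum number of vertices of a graph $G$ with $G\overset{v}{\rightarrow}(b_1,\dots,b_t)$ and $\omega(G)<q$ (it exists iff $q>\max\{b_i\}$). For positive integers $m,p$, $G\overset{v}{\rightarrow}\langle m\rangle_p$ means that $G\overset{v}{\rightarrow}(b_1,\dots,b_t)$ for every choice of positive integers $b_1,\dots,b_t$ ($t$ not fixed) with $\sum_{i=1}^t(b_i-1)+1=m$ and $\max\{b_i\}\le p$. The modified vertex Folkman number $\widetilde{F}_v(m;p;q)$ is the minimum number of vertices of a graph $G$ with $G\overset{v}{\rightarrow}\langle m\rangle_p$ and $\omega(G)<q$. -}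

module Defs where

open import Data.Nat using (ℕ; _≤_; _<_; _+_; _∸_; _⊔_)
open import Data.Bool using (Bool; true; false)
open import Data.Fin using (Fin)
open import Data.List using (List; []; _∷_; length; lookup; map; foldr; replicate; _++_; [_])
open import Data.Nat.ListAction using (sum)
open import Data.List.Relation.Unary.All using (All)
open import Data.Product using (Σ; ∃; ∃-syntax; _×_; _,_)
open import Relation.Binary.PropositionalEquality using (_≡_; _≢_)
open import Relation.Nullary using (¬_)
open import Function.Definitions using (Injective)

record Graph (n : ℕ) : Set where
  field
    adj   : Fin n → Fin n → Bool
    sym   : ∀ u v → adj u v ≡ adj v u
    irrefl : ∀ v → adj v v ≡ false
open Graph public

IsClique : ∀ {n} → Graph n → (b : ℕ) → (Fin b → Fin n) → Set
IsClique G b f = Injective _≡_ _≡_ f × (∀ i j → i ≢ j → adj G (f i) (f j) ≡ true)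

HasClique : ∀ {n} → Graph n → ℕ → Set
HasClique {n} G b = ∃[ f ] IsClique G b f

CliqueNumberLt : ∀ {n} → Graph n → ℕ → Set
CliqueNumberLt G q = ¬ HasClique G q

Arrows : ∀ {n} → Graph n → List ℕ → Set
Arrows {n} G bs =
  (c : Fin n → Fin (length bs)) →
  ∃[ i ] ∃[ f ] (IsClique G (lookup bs i) f × (∀ k → c (f k) ≡ i))

mOf : List ℕ → ℕ
mOf bs = sum (map (λ b → b ∸ 1) bs) + 1

maxOf : List ℕ → ℕ
maxOf = foldr _⊔_ 0

Positive : ℕ → Set
Positive b = 1 ≤ b

NonEmpty : List ℕ → Set
NonEmpty bs = 1 ≤ length bs

ArrowsMod : ∀ {n} → Graph n → ℕ → ℕ → Set
ArrowsMod G m p =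
  (bs : List ℕ) → NonEmpty bs → All Positive bs →
  mOf bs ≡ m → maxOf bs ≤ p → Arrows G bs

IsFv : List ℕ → ℕ → ℕ → Set
IsFv bs q N =
  (Σ (Graph N) λ G → Arrows G bs × CliqueNumberLt G q) ×
  (∀ n (G : Graph n) → Arrows G bs → CliqueNumberLt G q → N ≤ n)

IsFvMod : ℕ → ℕ → ℕ → ℕ → Set
IsFvMod m p q N =
  (Σ (Graph N) λ G → ArrowsMod G m p × CliqueNumberLt G q) ×
  (∀ n (G : Graph n) → ArrowsMod G m p → CliqueNumberLt G q → N ≤ n)

twosThen : ℕ → ℕ → List ℕ
twosThen m p = replicate (m ∸ p) 2 ++ [ p ]

module Submission where

-- The upper bound is immediate, since G →v ⟨m⟩_p includes G →v (a₁,…,aₛ).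
-- For the lower bound fix j with aⱼ = p and take a colouring by m − p colours of kind 2
-- and one colour of kind p. Cut the colours of kind 2 into consecutive blocks, one of
-- size aᵢ − 1 for each i ≠ j, merge block i into colour i and the last colour into
-- colour j. A monochromatic aⱼ-clique of colour j is a p-clique in the last colour; a
-- monochromatic aᵢ-clique of colour i ≠ j sees only aᵢ − 1 of the original colours, so by
-- pigeonhole two of its vertices form a monochromatic edge.

open import Defs hiding (sym)
open import Data.Nat using (ℕ; _≤_; _<_)
open import Data.List using (List)
open import Data.List.Relation.Unary.All using (All)
open import Data.Product using (_×_)

open import Data.Nat using (zero; suc; _+_; _∸_; pred; z<s; s<s; _<?_)
open import Data.Nat.Properties
  using (≤-refl; +-comm; m+n∸m≡n; ⊔-sel; ⊔-identityʳ; ∸-monoʳ-<)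
import Data.Nat.ListAction as List
open import Data.List using ([]; _∷_; length; lookup; map; replicate; _++_; [_])
import Data.List.Relation.Unary.All as All
open import Data.List.Membership.Propositional.Properties using (∈-lookup)
open import Data.Fin
  using (Fin; zero; suc; toℕ; _≟_; fromℕ<; splitAt; join; _↑ˡ_; _↑ʳ_; punchIn)
open import Data.Fin.Properties
  using ( toℕ-injective; toℕ-fromℕ<; toℕ<n; join-splitAt; punchIn-injective; punchInᵢ≢i
        ; pigeonhole; <⇒≢)
open import Data.Vec.Functional using (Vector; tail; removeAt)
open import Algebra.Properties.CommutativeMonoid.Sum Data.Nat.Properties.+-0-commutativeMonoid
  using (sum; sum-remove)
open import Data.Maybe using (Maybe; just; nothing)
open import Data.Product using (Σ-syntax; ∃-syntax; _,_; proj₁; proj₂)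
open import Data.Sum using (inj₁; inj₂)
open import Data.Bool using (true)
open import Function using (_∘_; id)
open import Relation.Nullary using (¬_; yes; no; contradiction)
open import Relation.Binary.PropositionalEquality
  using (_≡_; _≢_; refl; sym; trans; cong; subst; subst₂; module ≡-Reasoning)

splitSum : ∀ {s} (ws : Vector ℕ s) → Fin (sum ws) → Σ[ i ∈ Fin s ] Fin (ws i)
splitSum {suc s} ws r with splitAt (ws zero) r
... | inj₁ o  = zero , o
... | inj₂ r′ = Data.Product.map suc id (splitSum (tail ws) r′)

joinSum : ∀ {s} (ws : Vector ℕ s) → Σ[ i ∈ Fin s ] Fin (ws i) → Fin (sum ws)
joinSum ws (zero  , o) = o ↑ˡ sum (tail ws)
joinSum ws (suc i , o) = ws zero ↑ʳ joinSum (tail ws) (i , o)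

splitAt≡⇒join≡ : ∀ m {n} {r : Fin (m + n)} {e} → splitAt m r ≡ e → join m n e ≡ r
splitAt≡⇒join≡ m {n} {r} eq = trans (cong (join m n) (sym eq)) (join-splitAt m n r)

joinSum-splitSum : ∀ {s} (ws : Vector ℕ s) r → joinSum ws (splitSum ws r) ≡ r
joinSum-splitSum {suc s} ws r with splitAt (ws zero) r in eq
... | inj₁ o  = splitAt≡⇒join≡ (ws zero) eq
... | inj₂ r′ = trans (cong (ws zero ↑ʳ_) (joinSum-splitSum (tail ws) r′))
                      (splitAt≡⇒join≡ (ws zero) eq)

splitSum-injective : ∀ {s} (ws : Vector ℕ s) {r r′} →
  splitSum ws r ≡ splitSum ws r′ → r ≡ r′
splitSum-injective ws {r} {r′} eq =
  trans (sym (joinSum-splitSum ws r)) (trans (cong (joinSum ws) eq) (joinSum-splitSum ws r′))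

Σ-≡-toℕ : ∀ {s} {ws : Vector ℕ s} {d e : Σ[ i ∈ Fin s ] Fin (ws i)} →
  proj₁ d ≡ proj₁ e → toℕ (proj₂ d) ≡ toℕ (proj₂ e) → d ≡ e
Σ-≡-toℕ {d = i , o} {e = .i , o′} refl eq = cong (i ,_) (toℕ-injective eq)

MonoClique : ∀ {n} {C : Set} → Graph n → (Fin n → C) → ℕ → C → Set
MonoClique G c a K = ∃[ f ] (IsClique G a f × (∀ x → c (f x) ≡ K))

-- `Arrows G bs` is `ArrowsVec G (lookup bs)` by definition.
ArrowsVec : ∀ {n t} → Graph n → Vector ℕ t → Set
ArrowsVec G b = ∀ c → ∃[ i ] MonoClique G c (b i) i

pair : ∀ {n} → Fin n → Fin n → Fin 2 → Fin n
pair u v zero    = u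
pair u v (suc _) = v

pair-isClique : ∀ {n} (G : Graph n) {u v} →
  u ≢ v → adj G u v ≡ true → IsClique G 2 (pair u v)
pair-isClique G {u} {v} u≢v uv = injective , adjacent
  where
  injective : ∀ {x y} → pair u v x ≡ pair u v y → x ≡ y
  injective {zero}     {zero}     _  = refl
  injective {zero}     {suc zero} eq = contradiction eq u≢v
  injective {suc zero} {zero}     eq = contradiction (sym eq) u≢v
  injective {suc zero} {suc zero} _  = refl
  adjacent : ∀ x y → x ≢ y → adj G (pair u v x) (pair u v y) ≡ true
  adjacent zero       zero       x≢y = contradiction refl x≢y
  adjacent zero       (suc zero) _   = uv
  adjacent (suc zero) zero       _   = trans (Graph.sym G v u) uv
  adjacent (suc zero) (suc zero) x≢y = contradiction refl x≢y

monoEdge-pigeonhole : ∀ {n a k} {C : Set} (G : Graph n) (c : Fin n → C) {f : Fin a → Fin n} →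
  IsClique G a f → k < a → (ι : Fin a → Fin k) →
  (∀ x y → ι x ≡ ι y → c (f x) ≡ c (f y)) →
  ∃[ x ] MonoClique G c 2 (c (f x))
monoEdge-pigeonhole G c {f} (f-injective , f-adjacent) k<a ι ι-determines
  with pigeonhole k<a ι
... | x , y , x<y , ιx≡ιy =
  x , pair (f x) (f y) , pair-isClique G (x≢y ∘ f-injective) (f-adjacent x y x≢y) , colour
  where
  x≢y : x ≢ y
  x≢y = <⇒≢ x<y
  colour : ∀ z → c (pair (f x) (f y) z) ≡ c (f x)
  colour zero    = refl
  colour (suc _) = sym (ι-determines x y ιx≡ιy)

module ReplicateSnoc (b p : ℕ) where

  lastIndex : ∀ k → Fin (length (replicate k b ++ [ p ]))
  lastIndex zero    = zero
  lastIndex (suc k) = suc (lastIndex k)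

  lookup-lastIndex : ∀ k → lookup (replicate k b ++ [ p ]) (lastIndex k) ≡ p
  lookup-lastIndex zero    = refl
  lookup-lastIndex (suc k) = lookup-lastIndex k

  lookup-replicate-++ : ∀ k (x : Fin (length (replicate k b ++ [ p ]))) →
    toℕ x < k → lookup (replicate k b ++ [ p ]) x ≡ b
  lookup-replicate-++ (suc k) zero    _         = refl
  lookup-replicate-++ (suc k) (suc x) (s<s x<k) = lookup-replicate-++ k x x<k

  ≮⇒≡lastIndex : ∀ k (x : Fin (length (replicate k b ++ [ p ]))) →
    ¬ toℕ x < k → x ≡ lastIndex k
  ≮⇒≡lastIndex zero    zero    _   = refl
  ≮⇒≡lastIndex (suc k) zero    x≮k = contradiction z<s x≮k
  ≮⇒≡lastIndex (suc k) (suc x) x≮k = cong suc (≮⇒≡lastIndex k x (x≮k ∘ s<s))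

  prefixIndex : ∀ k → Fin (length (replicate k b ++ [ p ])) → Maybe (Fin k)
  prefixIndex k x with toℕ x <? k
  ... | yes x<k = just (fromℕ< x<k)
  ... | no  _   = nothing

  prefixIndex-nothing : ∀ k x → prefixIndex k x ≡ nothing → x ≡ lastIndex k
  prefixIndex-nothing k x eq with toℕ x <? k
  prefixIndex-nothing k x () | yes _
  ... | no x≮k = ≮⇒≡lastIndex k x x≮k

  prefixIndex-just : ∀ k x {t} → prefixIndex k x ≡ just t → toℕ x < k × toℕ t ≡ toℕ x
  prefixIndex-just k x eq with toℕ x <? k
  prefixIndex-just k x refl | yes x<k = x<k , toℕ-fromℕ< x<k
  prefixIndex-just k x ()   | no _

  prefixIndex-just-injective : ∀ k {x y t} →
    prefixIndex k x ≡ just t → prefixIndex k y ≡ just t → x ≡ y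
  prefixIndex-just-injective k {x} {y} eqx eqy = toℕ-injective
    (trans (sym (proj₂ (prefixIndex-just k x eqx))) (proj₂ (prefixIndex-just k y eqy)))

module _ {n s : ℕ} (G : Graph n) (b : Vector ℕ (suc s)) (j : Fin (suc s)) where

  blocks : Vector ℕ s
  blocks = removeAt (pred ∘ b) j

  open ReplicateSnoc 2 (b j)

  Colour : Set
  Colour = Fin (length (replicate (sum blocks) 2 ++ [ b j ]))

  blockOf : Maybe (Fin (sum blocks)) → Fin (suc s)
  blockOf (just t) = punchIn j (proj₁ (splitSum blocks t))
  blockOf nothing  = j

  blockOf-≡j : ∀ m → blockOf m ≡ j → m ≡ nothing
  blockOf-≡j (just t) eq = contradiction eq (punchInᵢ≢i j _)
  blockOf-≡j nothing  _  = refl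

  blockOf-≢j : ∀ m {i} → blockOf m ≡ i → i ≢ j →
    ∃[ t ] (m ≡ just t × punchIn j (proj₁ (splitSum blocks t)) ≡ i)
  blockOf-≢j (just t) eq _   = t , refl , eq
  blockOf-≢j nothing  eq i≢j = contradiction (sym eq) i≢j

  merge : Colour → Fin (suc s)
  merge = blockOf ∘ prefixIndex (sum blocks)

  twoColouredEdge : (c : Fin n → Colour) {i : Fin (suc s)} {f : Fin (b i) → Fin n} →
    i ≢ j → 1 ≤ b i → IsClique G (b i) f → (∀ x → merge (c (f x)) ≡ i) →
    ∃[ K ] MonoClique G c (lookup (replicate (sum blocks) 2 ++ [ b j ]) K) K
  twoColouredEdge c {i} {f} i≢j 1≤bᵢ clique mono =
    let x , edge = monoEdge-pigeonhole G c clique (∸-monoʳ-< z<s 1≤bᵢ) label label-determines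
        x<k      = proj₁ (prefixIndex-just (sum blocks) _ (code≡ x))
    in  c (f x) , subst (λ a → MonoClique G c a (c (f x)))
                        (sym (lookup-replicate-++ (sum blocks) _ x<k)) edge
    where
    decoded : ∀ x → ∃[ t ] (prefixIndex (sum blocks) (c (f x)) ≡ just t ×
                             punchIn j (proj₁ (splitSum blocks t)) ≡ i)
    decoded x = blockOf-≢j (prefixIndex (sum blocks) (c (f x))) (mono x) i≢j
    code : Fin (b i) → Fin (sum blocks)
    code x = proj₁ (decoded x)
    code≡ : ∀ x → prefixIndex (sum blocks) (c (f x)) ≡ just (code x)
    code≡ x = proj₁ (proj₂ (decoded x))
    block : Fin (b i) → Fin s
    block x = proj₁ (splitSum blocks (code x))
    withinBlock : ∀ x → Fin (blocks (block x))
    withinBlock x = proj₂ (splitSum blocks (code x))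
    punchIn-block≡ : ∀ x → punchIn j (block x) ≡ i
    punchIn-block≡ x = proj₂ (proj₂ (decoded x))
    withinBlock< : ∀ x → toℕ (withinBlock x) < b i ∸ 1
    withinBlock< x = subst (λ i′ → toℕ (withinBlock x) < b i′ ∸ 1) (punchIn-block≡ x) (toℕ<n _)
    label : Fin (b i) → Fin (b i ∸ 1)
    label x = fromℕ< (withinBlock< x)
    label-determines : ∀ x y → label x ≡ label y → c (f x) ≡ c (f y)
    label-determines x y eq =
      prefixIndex-just-injective (sum blocks) (code≡ x)
                                 (trans (code≡ y) (cong just (sym same-code)))
      where
      same-block : block x ≡ block y
      same-block = punchIn-injective j _ _ (trans (punchIn-block≡ x) (sym (punchIn-block≡ y)))
      same-offset : toℕ (withinBlock x) ≡ toℕ (withinBlock y)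
      same-offset = trans (sym (toℕ-fromℕ< (withinBlock< x)))
                          (trans (cong toℕ eq) (toℕ-fromℕ< (withinBlock< y)))
      same-code : code x ≡ code y
      same-code = splitSum-injective blocks (Σ-≡-toℕ same-block same-offset)

  arrows-splitOffTwos : (∀ i → i ≢ j → 1 ≤ b i) → ArrowsVec G b →
    Arrows G (replicate (sum blocks) 2 ++ [ b j ])
  arrows-splitOffTwos positive arrows c with arrows (merge ∘ c)
  ... | i , f , clique , mono with i ≟ j
  ...   | no i≢j   = twoColouredEdge c i≢j (positive i i≢j) clique mono
  ...   | yes refl =
    lastIndex (sum blocks) ,
    subst (λ a → MonoClique G c a (lastIndex (sum blocks))) (sym (lookup-lastIndex (sum blocks)))
          (f , clique , λ x → prefixIndex-nothing (sum blocks) _ (blockOf-≡j _ (mono x)))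

sum-map-lookup : ∀ (g : ℕ → ℕ) xs → List.sum (map g xs) ≡ sum (g ∘ lookup xs)
sum-map-lookup g []       = refl
sum-map-lookup g (x ∷ xs) = cong (g x +_) (sum-map-lookup g xs)

maxOf-attained : ∀ a as → ∃[ j ] lookup (a ∷ as) j ≡ maxOf (a ∷ as)
maxOf-attained a []        = zero , sym (⊔-identityʳ a)
maxOf-attained a (a′ ∷ as) with maxOf-attained a′ as | ⊔-sel a (maxOf (a′ ∷ as))
... | _ , _      | inj₁ a⊔max≡a   = zero , sym a⊔max≡a
... | j , bⱼ≡max | inj₂ a⊔max≡max = suc j , trans bⱼ≡max (sym a⊔max≡max)

pred+n+1∸≡n : ∀ {x} n → 1 ≤ x → (x ∸ 1 + n) + 1 ∸ x ≡ n
pred+n+1∸≡n {suc x} n _ = trans (cong (_∸ suc x) (+-comm (x + n) 1)) (m+n∸m≡n x n)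

mOf∸≡sum-removeAt : ∀ a as (j : Fin (suc (length as))) → 1 ≤ lookup (a ∷ as) j →
  mOf (a ∷ as) ∸ lookup (a ∷ as) j ≡ sum (removeAt (pred ∘ lookup (a ∷ as)) j)
mOf∸≡sum-removeAt a as j 1≤bⱼ = begin
  mOf (a ∷ as) ∸ bⱼ
    ≡⟨ cong (λ m → m + 1 ∸ bⱼ) (sum-map-lookup pred (a ∷ as)) ⟩
  sum (pred ∘ b) + 1 ∸ bⱼ
    ≡⟨ cong (λ m → m + 1 ∸ bⱼ) (sum-remove {i = j} (pred ∘ b)) ⟩
  (pred bⱼ + sum (removeAt (pred ∘ b) j)) + 1 ∸ bⱼ
    ≡⟨ pred+n+1∸≡n _ 1≤bⱼ ⟩
  sum (removeAt (pred ∘ b) j)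
    ∎
  where
  open ≡-Reasoning
  b : Fin (suc (length as)) → ℕ
  b = lookup (a ∷ as)
  bⱼ : ℕ
  bⱼ = b j

arrows-twosThen : ∀ {n} (G : Graph n) as → NonEmpty as → All Positive as →
  Arrows G as → Arrows G (twosThen (mOf as) (maxOf as))
arrows-twosThen G (a ∷ as) _ positive arrows =
  subst₂ (λ k p → Arrows G (replicate k 2 ++ [ p ])) twos≡ bⱼ≡max
         (arrows-splitOffTwos G b j (λ i _ → 1≤b i) arrows)
  where
  b : Fin (suc (length as)) → ℕ
  b = lookup (a ∷ as)
  1≤b : ∀ i → 1 ≤ b i
  1≤b i = All.lookup positive (∈-lookup i)
  j : Fin (suc (length as))
  j = proj₁ (maxOf-attained a as)
  bⱼ≡max : b j ≡ maxOf (a ∷ as)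
  bⱼ≡max = proj₂ (maxOf-attained a as)
  twos≡ : sum (blocks G b j) ≡ mOf (a ∷ as) ∸ maxOf (a ∷ as)
  twos≡ = trans (sym (mOf∸≡sum-removeAt a as j (1≤b j))) (cong (mOf (a ∷ as) ∸_) bⱼ≡max)

theorem1p19 : (as : List ℕ) → NonEmpty as → All Positive as →
    (q : ℕ) → maxOf as < q →
    (N₁ N₂ N₃ : ℕ) →
    IsFv (twosThen (mOf as) (maxOf as)) q N₁ →
    IsFv as q N₂ →
    IsFvMod (mOf as) (maxOf as) q N₃ →
    N₁ ≤ N₂ × N₂ ≤ N₃
theorem1p19 as nonEmpty positive q _ N₁ N₂ N₃
            (_ , minimal₁) ((G₂ , arrows₂ , ω₂<q) , minimal₂) ((G₃ , arrows₃ , ω₃<q) , _) =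
  minimal₁ N₂ G₂ (arrows-twosThen G₂ as nonEmpty positive arrows₂) ω₂<q ,
  minimal₂ N₃ G₃ (arrows₃ as nonEmpty positive refl ≤-refl) ω₃<q
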